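{- Let $\mathcal H\subseteq 2^V$ be a Sperner hypergraph, $V=V_1\dot\cup V_2$ with $V_1,V_2\neq\emptyset$, and $S_0,S_1,S_2\subseteq V_1$ pairwise disjoint nonempty sets. Let $\mathcal H_1=\mathcal H_{V_1}\neq\emptyset$, $\mathcal H_2=\mathcal H_{V_2}$, $\mathcal F_1=\{H\in\mathcal H\mid H\cap V_1=S_0\cup S_2,\ H\cap V_2\ne\emptyset\}$, $\mathcal F_2=\{H\in\mathcal H\mid H\cap V_1=S_0\cup S_1,\ H\cap V_2\ne\emptyset\}$, with $\mathcal F_1,\mathcal F_2\neq\emptyset$ and $\mathcal H=\mathcal H_1\cup\mathcal H_2\cup\mathcal F_1\cup\mathcal F_2$. For $i=0,1,2$ let $\mathcal T_i=\{T\in\operatorname{Tr}(\mathcal H_1)\mid T\cap S_i\neq\emptyset,\ T\cap S_j=\emptyset\ (j\neq i)\}$, let $\mathcal T=\operatorname{Tr}(\mathcal H_1)\setminus(\mathcal T_0\cup\mathcal T_1\cup\mathcal T_2)$, for $i=1,2$ let $\mathcal F_i'=\operatorname{Min}(\mathcal F_i^{V_2}\cup\mathcal H_2)$, and let $\mathcal P=\mathcal H_{S_0\cup S_1\cup S_2}$. Assume $\mathcal P\neq\emptyset$ and $\mathcal T\neq\emptyset$. Then the three families $(\mathcal T\cup\mathcal T_0)\dot\wedge\operatorname{Tr}(\mathcal H_2)$, $\mathcal T_1\dot\wedge\operatorname{Tr}(\mathcal F_1')$ and $\mathcal T_2\dot\wedge\operatorname{Tr}(\mathcal F_2')$ are pairwise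 disjoint and their union is contained in $\operatorname{Tr}(\mathcal H)$.
   Context: $\operatorname{Tr}(\mathcal G)$ is the family of inclusion-minimal transversals of $\mathcal G$ (sets meeting every hyperedge), with $\operatorname{Tr}(\emptyset)=\{\emptyset\}$. A hypergraph is Sperner if no hyperedge contains another. $\mathcal H_S=\{H\in\mathcal H\mid H\subseteq S\}$; $\mathcal G^S=\operatorname{Min}\{G\cap S\mid G\in\mathcal G\}$; $\operatorname{Min}$ takes inclusion-minimal members. For families $\mathcal A,\mathcal B$ on disjoint vertex sets, $\mathcal A\dot\wedge\mathcal B=\operatorname{Min}\{A\cup B\mid A\in\mathcal A,B\in\mathcal B\}$. -}

module Defs where

open import Data.Nat using (ℕ)
open import Data.Product using (Σ; ∃; _×_; _,_)
open import Data.Sum using (_⊎_)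
open import Data.Empty using (⊥)
open import Relation.Nullary using (¬_)
open import Relation.Binary.PropositionalEquality using (_≡_)
open import Data.Fin.Subset public
  using (Subset; _∩_; _∪_; ∁; _⊆_; _⊂_; Nonempty; Empty)

Family : ℕ → Set₁
Family n = Subset n → Set

module _ {n : ℕ} where

  _∪F_ : Family n → Family n → Family n
  (𝒜 ∪F ℬ) X = 𝒜 X ⊎ ℬ X

  _∖F_ : Family n → Family n → Family n
  (𝒜 ∖F ℬ) X = 𝒜 X × ¬ ℬ X

  NonemptyF : Family n → Set
  NonemptyF 𝒜 = ∃ λ X → 𝒜 X

  Sperner : Family n → Set
  Sperner ℋ = ∀ A B → ℋ A → ℋ B → A ⊆ B → A ≡ B

  Min : Family n → Family n
  Min 𝒜 A = 𝒜 A × (∀ B → 𝒜 B → B ⊂ A → ⊥)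

  IsTransversal : Family n → Subset n → Set
  IsTransversal 𝒢 T = ∀ G → 𝒢 G → Nonempty (T ∩ G)

  -- Tr 𝒢 : inclusion-minimal transversals (Tr ∅ = {∅} automatically)
  Tr : Family n → Family n
  Tr 𝒢 = Min (IsTransversal 𝒢)

  Restrict : Family n → Subset n → Family n
  Restrict ℋ S H = ℋ H × H ⊆ S

  Trace : Family n → Subset n → Family n
  Trace 𝒢 S = Min (λ A → ∃ λ G → 𝒢 G × A ≡ G ∩ S)

  _∧̇_ : Family n → Family n → Family n
  𝒜 ∧̇ ℬ = Min (λ X → ∃ λ A → ∃ λ B → 𝒜 A × ℬ B × X ≡ A ∪ B)

  DisjointF : Family n → Family n → Set
  DisjointF 𝒜 ℬ = ∀ X → 𝒜 X → ℬ X → ⊥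

  _⊆F_ : Family n → Family n → Set
  𝒜 ⊆F ℬ = ∀ X → 𝒜 X → ℬ X

-- Write X = A ∪ B with A ⊆ V₁ and B ⊆ V₂. The V₁-part A is determined by X, so the three
-- families are disjoint because their V₁-parts come from pairwise disjoint families
-- (𝒯 ∪ 𝒯₀, 𝒯₁, 𝒯₂). For the inclusion, A ∪ B meets every edge: edges inside V₁ via A, edges
-- inside V₂ via B, and a crossing edge H either via A (when A meets H ∩ V₁ ∈ {S₀ ∪ S₁, S₀ ∪ S₂})
-- or via B (when B is a transversal of the traces of such edges on V₂). It is minimal because
-- for any transversal Y ⊂ A ∪ B, Y ∩ V₁ is a transversal of ℋ₁ and Y ∩ V₂ one of the family
-- B is minimal for: for 𝒯₁, a point of Y in a crossing edge H ∈ ℱ₁ cannot lie in V₁, since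
-- there it would be in A ∩ (S₀ ∪ S₂) = ∅. The hypothesis 𝒫 ≠ ∅ is what forces every A ∈ 𝒯 to
-- meet both S₀ ∪ S₁ and S₀ ∪ S₂.
module Submission where

open import Defs
open import Data.Nat using (ℕ)
open import Data.Product using (_×_; _,_; proj₁; proj₂)
open import Data.Sum using (_⊎_; inj₁; inj₂; [_,_])
open import Data.Empty using (⊥; ⊥-elim)
open import Function using (_∘_)
open import Relation.Nullary using (¬_; yes; no)
open import Relation.Binary.PropositionalEquality using (_≡_; refl; sym; trans; subst)
open import Induction.WellFounded using (Acc; acc)
open import Data.Fin.Subset using (_∈_)
open import Data.Fin.Subset.Induction using (⊂-wellFounded)
open import Data.Fin.Subset.Properties

module _ {n : ℕ} where

  meets-mono : ∀ {T T′ G G′ : Subset n} → T ⊆ T′ → G ⊆ G′ →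
               Nonempty (T ∩ G) → Nonempty (T′ ∩ G′)
  meets-mono T⊆T′ G⊆G′ (y , y∈T∩G) =
    let y∈T , y∈G = x∈p∩q⁻ _ _ y∈T∩G in y , x∈p∩q⁺ (T⊆T′ y∈T , G⊆G′ y∈G)

  meets-∩ : ∀ {T G W : Subset n} → G ⊆ W → Nonempty (T ∩ G) → Nonempty ((T ∩ W) ∩ G)
  meets-∩ G⊆W (y , y∈T∩G) =
    let y∈T , y∈G = x∈p∩q⁻ _ _ y∈T∩G in y , x∈p∩q⁺ (x∈p∩q⁺ (y∈T , G⊆W y∈G) , y∈G)

  meets-∪⁻ : ∀ (T S S′ : Subset n) → Nonempty (T ∩ (S ∪ S′)) →
             Nonempty (T ∩ S) ⊎ Nonempty (T ∩ S′)
  meets-∪⁻ T S S′ (y , y∈T∩S∪S′) with x∈p∩q⁻ T _ y∈T∩S∪S′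
  ... | y∈T , y∈S∪S′ with x∈p∪q⁻ S S′ y∈S∪S′
  ...   | inj₁ y∈S  = inj₁ (y , x∈p∩q⁺ (y∈T , y∈S))
  ...   | inj₂ y∈S′ = inj₂ (y , x∈p∩q⁺ (y∈T , y∈S′))

  ∪-lub : ∀ {A B C : Subset n} → A ⊆ C → B ⊆ C → A ∪ B ⊆ C
  ∪-lub {A} {B} A⊆C B⊆C x∈A∪B with x∈p∪q⁻ A B x∈A∪B
  ... | inj₁ x∈A = A⊆C x∈A
  ... | inj₂ x∈B = B⊆C x∈B

  ∩-⊆-∪ˡ : ∀ {Y A B W : Subset n} → Y ⊆ A ∪ B → B ⊆ ∁ W → Y ∩ W ⊆ A
  ∩-⊆-∪ˡ {Y} {A} {B} {W} Y⊆A∪B B⊆∁W x∈Y∩W with x∈p∩q⁻ Y W x∈Y∩W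
  ... | x∈Y , x∈W with x∈p∪q⁻ A B (Y⊆A∪B x∈Y)
  ...   | inj₁ x∈A = x∈A
  ...   | inj₂ x∈B = ⊥-elim (x∈∁p⇒x∉p (B⊆∁W x∈B) x∈W)

  ∩-⊆-∪ʳ : ∀ {Y A B W : Subset n} → Y ⊆ A ∪ B → A ⊆ W → Y ∩ ∁ W ⊆ B
  ∩-⊆-∪ʳ {Y} {A} {B} {W} Y⊆A∪B A⊆W x∈Y∩∁W with x∈p∩q⁻ Y (∁ W) x∈Y∩∁W
  ... | x∈Y , x∈∁W with x∈p∪q⁻ A B (Y⊆A∪B x∈Y)
  ...   | inj₁ x∈A = ⊥-elim (x∈∁p⇒x∉p x∈∁W (A⊆W x∈A))
  ...   | inj₂ x∈B = x∈B

  meets-pair : ∀ (A S₀ S₁ S₂ : Subset n) → Nonempty (A ∩ ((S₀ ∪ S₁) ∪ S₂)) →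
               ¬ (Nonempty (A ∩ S₁) × Empty (A ∩ S₀) × Empty (A ∩ S₂)) →
               ¬ (Nonempty (A ∩ S₂) × Empty (A ∩ S₀) × Empty (A ∩ S₁)) →
               Nonempty (A ∩ (S₀ ∪ S₂)) × Nonempty (A ∩ (S₀ ∪ S₁))
  meets-pair A S₀ S₁ S₂ meets-all not-only-S₁ not-only-S₂
    with nonempty? (A ∩ S₀) | nonempty? (A ∩ S₁) | nonempty? (A ∩ S₂)
  ... | yes m₀ | _      | _      = meets-mono ⊆-refl (p⊆p∪q S₂) m₀ , meets-mono ⊆-refl (p⊆p∪q S₁) m₀
  ... | no _   | yes m₁ | yes m₂ = meets-mono ⊆-refl (q⊆p∪q S₀ S₂) m₂ , meets-mono ⊆-refl (q⊆p∪q S₀ S₁) m₁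
  ... | no e₀  | yes m₁ | no e₂  = ⊥-elim (not-only-S₁ (m₁ , e₀ , e₂))
  ... | no e₀  | no e₁  | yes m₂ = ⊥-elim (not-only-S₂ (m₂ , e₀ , e₁))
  ... | no e₀  | no e₁  | no e₂  =
    ⊥-elim ([ [ e₀ , e₁ ] ∘ meets-∪⁻ A S₀ S₁ , e₂ ] (meets-∪⁻ A (S₀ ∪ S₁) S₂ meets-all))

  ∪-partˡ-unique : ∀ {V A B A′ B′ : Subset n} → A ⊆ V → A′ ⊆ V → B ⊆ ∁ V → B′ ⊆ ∁ V →
                   A ∪ B ≡ A′ ∪ B′ → A ≡ A′
  ∪-partˡ-unique {V} {A} {B} {A′} {B′} A⊆V A′⊆V B⊆∁V B′⊆∁V A∪B≡A′∪B′ =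
    ⊆-antisym (part A∪B≡A′∪B′ A⊆V B′⊆∁V) (part (sym A∪B≡A′∪B′) A′⊆V B⊆∁V)
    where
    part : ∀ {A B A′ B′} → A ∪ B ≡ A′ ∪ B′ → A ⊆ V → B′ ⊆ ∁ V → A ⊆ A′
    part {A} {B} eq A⊆V B′⊆∁V x∈A =
      ∩-⊆-∪ˡ (subst (A ⊆_) eq (p⊆p∪q B)) B′⊆∁V (x∈p∩q⁺ (x∈A , A⊆V x∈A))

  IsTransversal-⊆F : ∀ {𝒢 ℋ : Family n} {T} → 𝒢 ⊆F ℋ → IsTransversal ℋ T → IsTransversal 𝒢 T
  IsTransversal-⊆F 𝒢⊆ℋ T-tr G g = T-tr G (𝒢⊆ℋ G g)

  IsTransversal-∩ : ∀ {𝒢 : Family n} {T W} → (∀ G → 𝒢 G → G ⊆ W) →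
                    IsTransversal 𝒢 T → IsTransversal 𝒢 (T ∩ W)
  IsTransversal-∩ edges⊆W T-tr G g = meets-∩ (edges⊆W G g) (T-tr G g)

  IsTransversal-Restrict : ∀ {ℋ : Family n} {T} W →
                           IsTransversal ℋ T → IsTransversal (Restrict ℋ W) (T ∩ W)
  IsTransversal-Restrict W T-tr =
    IsTransversal-∩ (λ _ → proj₂) (IsTransversal-⊆F (λ _ → proj₁) T-tr)

  -- Well-founded induction on ⊂: if T missed G ∈ 𝒜, T would meet every smaller member of 𝒜
  -- by induction, so G would be minimal and hence met after all.
  IsTransversal-Min⁻ : ∀ {𝒜 : Family n} {T} → IsTransversal (Min 𝒜) T → IsTransversal 𝒜 T
  IsTransversal-Min⁻ {𝒜} {T} T-tr G = go G (⊂-wellFounded G)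
    where
    go : ∀ G → Acc _⊂_ G → 𝒜 G → Nonempty (T ∩ G)
    go G (acc smaller) g with nonempty? (T ∩ G)
    ... | yes T-meets-G = T-meets-G
    ... | no T-misses-G = ⊥-elim (T-misses-G (T-tr G (g , below)))
      where
      below : ∀ B → 𝒜 B → B ⊂ G → ⊥
      below B b B⊂G = T-misses-G (meets-mono ⊆-refl (p⊂q⇒p⊆q B⊂G) (go B (smaller B⊂G) b))

  Tr-⊆ : ∀ {𝒢 : Family n} {W T} → (∀ G → 𝒢 G → G ⊆ W) → Tr 𝒢 T → T ⊆ W
  Tr-⊆ {W = W} {T} edges⊆W (T-tr , T-min) {x} x∈T with x ∈? W
  ... | yes x∈W = x∈W
  ... | no  x∉W = ⊥-elim (T-min (T ∩ W) (IsTransversal-∩ edges⊆W T-tr)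
                                (p∩q⊆p T W , x , x∈T , x∉W ∘ p∩q⊆q T W))

  Tr-Restrict-⊆ : ∀ {ℋ : Family n} {W T} → Tr (Restrict ℋ W) T → T ⊆ W
  Tr-Restrict-⊆ = Tr-⊆ (λ _ → proj₂)

  Tr-∪ : ∀ {ℋ 𝒢 : Family n} {V A B} → Tr (Restrict ℋ V) A → Tr 𝒢 B → B ⊆ ∁ V →
         IsTransversal ℋ (A ∪ B) →
         (∀ {Y} → Y ⊆ A ∪ B → IsTransversal ℋ Y → IsTransversal 𝒢 (Y ∩ ∁ V)) →
         Tr ℋ (A ∪ B)
  Tr-∪ {V = V} {A} {B} A-Tr B-Tr B⊆∁V A∪B-tr restricts = A∪B-tr , minimal
    where
    minimal : ∀ Y → IsTransversal _ Y → Y ⊂ A ∪ B → ⊥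
    minimal Y Y-tr (Y⊆A∪B , x , x∈A∪B , x∉Y) with x∈p∪q⁻ A B x∈A∪B
    ... | inj₁ x∈A = proj₂ A-Tr (Y ∩ V) (IsTransversal-Restrict V Y-tr)
                       (∩-⊆-∪ˡ Y⊆A∪B B⊆∁V , x , x∈A , x∉Y ∘ p∩q⊆p Y V)
    ... | inj₂ x∈B = proj₂ B-Tr (Y ∩ ∁ V) (restricts Y⊆A∪B Y-tr)
                       (∩-⊆-∪ʳ Y⊆A∪B (Tr-Restrict-⊆ A-Tr) , x , x∈B , x∉Y ∘ p∩q⊆p Y (∁ V))

  ∧̇-disjoint : ∀ {𝒜 ℬ 𝒢 𝒢′ : Family n} V →
               (∀ {A} → 𝒜 A → A ⊆ V) → (∀ {A} → ℬ A → A ⊆ V) →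
               (∀ {B} → 𝒢 B → B ⊆ ∁ V) → (∀ {B} → 𝒢′ B → B ⊆ ∁ V) →
               DisjointF 𝒜 ℬ → DisjointF (𝒜 ∧̇ 𝒢) (ℬ ∧̇ 𝒢′)
  ∧̇-disjoint {ℬ = ℬ} V 𝒜⊆V ℬ⊆V 𝒢⊆∁V 𝒢′⊆∁V 𝒜∩ℬ=∅ X
             ((A , B , a , b , X≡A∪B) , _) ((A′ , B′ , a′ , b′ , X≡A′∪B′) , _) =
    𝒜∩ℬ=∅ A a (subst ℬ (sym A≡A′) a′)
    where
    A≡A′ = ∪-partˡ-unique (𝒜⊆V a) (ℬ⊆V a′) (𝒢⊆∁V b) (𝒢′⊆∁V b′)
                          (trans (sym X≡A∪B) X≡A′∪B′)

module Split {n : ℕ} (ℋ : Family n) (V : Subset n) where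

  Inner Outer : Family n
  Inner = Restrict ℋ V
  Outer = Restrict ℋ (∁ V)

  Crossing : Subset n → Family n
  Crossing S H = ℋ H × (H ∩ V ≡ S) × Nonempty (H ∩ ∁ V)

  CoveredBy : Subset n → Subset n → Set
  CoveredBy S S′ = ∀ H → ℋ H → (Inner H ⊎ Outer H) ⊎ (Crossing S H ⊎ Crossing S′ H)

  CoveredBy-swap : ∀ {S S′} → CoveredBy S S′ → CoveredBy S′ S
  CoveredBy-swap cover H h with cover H h
  ... | inj₁ inside           = inj₁ inside
  ... | inj₂ (inj₁ crossing)  = inj₂ (inj₂ crossing)
  ... | inj₂ (inj₂ crossing′) = inj₂ (inj₁ crossing′)

  Residual : Subset n → Family n
  Residual S = Min (Trace (Crossing S) (∁ V) ∪F Outer)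

  Tr-Residual-⊆ : ∀ {S B} → Tr (Residual S) B → B ⊆ ∁ V
  Tr-Residual-⊆ = Tr-⊆ edge⊆∁V
    where
    edge⊆∁V : ∀ {S} G → Residual S G → G ⊆ ∁ V
    edge⊆∁V G (inj₁ ((H , _ , G≡H∩∁V) , _) , _) = p∩q⊆q H (∁ V) ∘ subst (_ ∈_) G≡H∩∁V
    edge⊆∁V G (inj₂ (_ , G⊆∁V) , _)             = G⊆∁V

  meets-Crossing : ∀ {S A H} → H ∩ V ≡ S → Nonempty (A ∩ S) → Nonempty (A ∩ H)
  meets-Crossing H∩V≡S = meets-mono ⊆-refl (p∩q⊆p _ V ∘ subst (_ ∈_) (sym H∩V≡S))

  IsTransversal-∪ : ∀ {S S′ A B} → CoveredBy S S′ →
                    IsTransversal Inner A → IsTransversal Outer B →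
                    (∀ {H} → Crossing S H → Nonempty ((A ∪ B) ∩ H)) →
                    (∀ {H} → Crossing S′ H → Nonempty ((A ∪ B) ∩ H)) →
                    IsTransversal ℋ (A ∪ B)
  IsTransversal-∪ {A = A} {B} cover A-tr B-tr via-S via-S′ H h with cover H h
  ... | inj₁ (inj₁ inner)     = meets-mono (p⊆p∪q B) ⊆-refl (A-tr H inner)
  ... | inj₁ (inj₂ outer)     = meets-mono (q⊆p∪q A B) ⊆-refl (B-tr H outer)
  ... | inj₂ (inj₁ crossing)  = via-S crossing
  ... | inj₂ (inj₂ crossing′) = via-S′ crossing′

  Tr-∪-Outer : ∀ {S S′ A B} → CoveredBy S S′ → Tr Inner A →
               Nonempty (A ∩ S) → Nonempty (A ∩ S′) → Tr Outer B → Tr ℋ (A ∪ B)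
  Tr-∪-Outer {B = B} cover A-Tr A-meets-S A-meets-S′ B-Tr =
    Tr-∪ A-Tr B-Tr (Tr-Restrict-⊆ B-Tr) A∪B-tr (λ _ → IsTransversal-Restrict (∁ V))
    where
    A∪B-tr = IsTransversal-∪ cover (proj₁ A-Tr) (proj₁ B-Tr)
               (λ (_ , H∩V≡S , _) → meets-mono (p⊆p∪q B) ⊆-refl (meets-Crossing H∩V≡S A-meets-S))
               (λ (_ , H∩V≡S′ , _) → meets-mono (p⊆p∪q B) ⊆-refl (meets-Crossing H∩V≡S′ A-meets-S′))

  -- A point of Y in H lies outside V: inside V it would be in A ∩ (H ∩ V) = ∅.
  meets-outside : ∀ {Y A B H : Subset n} → Y ⊆ A ∪ B → B ⊆ ∁ V → Empty (A ∩ (H ∩ V)) →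
                  Nonempty (Y ∩ H) → Nonempty ((Y ∩ ∁ V) ∩ (H ∩ ∁ V))
  meets-outside {Y} {A} {B} {H} Y⊆A∪B B⊆∁V A-misses (y , y∈Y∩H) with x∈p∩q⁻ Y H y∈Y∩H
  ... | y∈Y , y∈H with y ∈? V
  ...   | yes y∈V = ⊥-elim (A-misses (y , x∈p∩q⁺ (∩-⊆-∪ˡ Y⊆A∪B B⊆∁V (x∈p∩q⁺ (y∈Y , y∈V))
                                                   , x∈p∩q⁺ (y∈H , y∈V))))
  ...   | no  y∉V = let y∈∁V = x∉p⇒x∈∁p y∉V in
                    y , x∈p∩q⁺ (x∈p∩q⁺ (y∈Y , y∈∁V) , x∈p∩q⁺ (y∈H , y∈∁V))

  Tr-∪-Residual : ∀ {S S′ A B} → CoveredBy S S′ → Tr Inner A →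
                  Empty (A ∩ S) → Nonempty (A ∩ S′) → Tr (Residual S) B → Tr ℋ (A ∪ B)
  Tr-∪-Residual {S} {A = A} {B} cover A-Tr A-misses-S A-meets-S′ B-Tr =
    Tr-∪ A-Tr B-Tr B⊆∁V A∪B-tr restricts
    where
    B⊆∁V = Tr-Residual-⊆ B-Tr
    B-tr : IsTransversal (Trace (Crossing S) (∁ V) ∪F Outer) B
    B-tr = IsTransversal-Min⁻ (proj₁ B-Tr)
    A∪B-tr = IsTransversal-∪ cover (proj₁ A-Tr) (IsTransversal-⊆F (λ _ → inj₂) B-tr)
      (λ {H} crossing → meets-mono (q⊆p∪q A B) (p∩q⊆p H (∁ V))
         (IsTransversal-Min⁻ (IsTransversal-⊆F (λ _ → inj₁) B-tr) (H ∩ ∁ V) (H , crossing , refl)))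
      (λ (_ , H∩V≡S′ , _) → meets-mono (p⊆p∪q B) ⊆-refl (meets-Crossing H∩V≡S′ A-meets-S′))
    restricts : ∀ {Y} → Y ⊆ A ∪ B → IsTransversal ℋ Y → IsTransversal (Residual S) (Y ∩ ∁ V)
    restricts _ Y-tr G (inj₂ outer , _) = IsTransversal-Restrict (∁ V) Y-tr G outer
    restricts Y⊆A∪B Y-tr G (inj₁ ((H , (h , H∩V≡S , _) , refl) , _) , _) =
      meets-outside Y⊆A∪B B⊆∁V (A-misses-S ∘ subst (λ Z → Nonempty (A ∩ Z)) H∩V≡S) (Y-tr H h)

module Lemma8 {n : ℕ} (ℋ : Family n) (V₁ S₀ S₁ S₂ : Subset n) where
  open Split ℋ V₁

  Only : Subset n → Subset n → Subset n → Family n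
  Only Sᵢ Sⱼ Sₖ T = Tr Inner T × Nonempty (T ∩ Sᵢ) × Empty (T ∩ Sⱼ) × Empty (T ∩ Sₖ)

  𝒯₀ 𝒯₁ 𝒯₂ 𝒯 𝒜 ℬ 𝒞 : Family n
  𝒯₀ = Only S₀ S₁ S₂
  𝒯₁ = Only S₁ S₀ S₂
  𝒯₂ = Only S₂ S₀ S₁
  𝒯 = Tr Inner ∖F ((𝒯₀ ∪F 𝒯₁) ∪F 𝒯₂)
  𝒜 = (𝒯 ∪F 𝒯₀) ∧̇ Tr Outer
  ℬ = 𝒯₁ ∧̇ Tr (Residual (S₀ ∪ S₂))
  𝒞 = 𝒯₂ ∧̇ Tr (Residual (S₀ ∪ S₁))

  𝒯∪𝒯₀⊆Tr : (𝒯 ∪F 𝒯₀) ⊆F Tr Inner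
  𝒯∪𝒯₀⊆Tr A (inj₁ (A-Tr , _)) = A-Tr
  𝒯∪𝒯₀⊆Tr A (inj₂ (A-Tr , _)) = A-Tr

  Only-⊆V₁ : ∀ {Sᵢ Sⱼ Sₖ A} → Only Sᵢ Sⱼ Sₖ A → A ⊆ V₁
  Only-⊆V₁ (A-Tr , _) = Tr-Restrict-⊆ A-Tr

  meets-both : NonemptyF (Restrict ℋ ((S₀ ∪ S₁) ∪ S₂)) → (S₀ ∪ S₁) ∪ S₂ ⊆ V₁ →
               ∀ A → (𝒯 ∪F 𝒯₀) A → Nonempty (A ∩ (S₀ ∪ S₂)) × Nonempty (A ∩ (S₀ ∪ S₁))
  meets-both _ _ A (inj₂ (_ , m₀ , _)) = meets-mono ⊆-refl (p⊆p∪q S₂) m₀ , meets-mono ⊆-refl (p⊆p∪q S₁) m₀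
  meets-both (P , P∈ℋ , P⊆S) S⊆V₁ A (inj₁ (A-Tr , not-Only)) =
    meets-pair A S₀ S₁ S₂ (meets-mono ⊆-refl P⊆S (proj₁ A-Tr P (P∈ℋ , ⊆-trans P⊆S S⊆V₁)))
      (λ (m₁ , e₀ , e₂) → not-Only (inj₁ (inj₂ (A-Tr , m₁ , e₀ , e₂))))
      (λ (m₂ , e₀ , e₁) → not-Only (inj₂ (A-Tr , m₂ , e₀ , e₁)))

  disjoint : DisjointF 𝒜 ℬ × DisjointF 𝒜 𝒞 × DisjointF ℬ 𝒞
  disjoint = ∧̇-disjoint V₁ 𝒯∪𝒯₀⊆V₁ Only-⊆V₁ Tr-Restrict-⊆ Tr-Residual-⊆ 𝒯∪𝒯₀∩𝒯₁=∅
           , ∧̇-disjoint V₁ 𝒯∪𝒯₀⊆V₁ Only-⊆V₁ Tr-Restrict-⊆ Tr-Residual-⊆ 𝒯∪𝒯₀∩𝒯₂=∅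
           , ∧̇-disjoint V₁ Only-⊆V₁ Only-⊆V₁ Tr-Residual-⊆ Tr-Residual-⊆ 𝒯₁∩𝒯₂=∅
    where
    𝒯∪𝒯₀⊆V₁ : ∀ {A} → (𝒯 ∪F 𝒯₀) A → A ⊆ V₁
    𝒯∪𝒯₀⊆V₁ a = Tr-Restrict-⊆ (𝒯∪𝒯₀⊆Tr _ a)
    𝒯∪𝒯₀∩𝒯₁=∅ : DisjointF (𝒯 ∪F 𝒯₀) 𝒯₁
    𝒯∪𝒯₀∩𝒯₁=∅ A (inj₁ (_ , not-Only)) a₁ = not-Only (inj₁ (inj₂ a₁))
    𝒯∪𝒯₀∩𝒯₁=∅ A (inj₂ (_ , m₀ , _)) (_ , _ , e₀ , _) = e₀ m₀
    𝒯∪𝒯₀∩𝒯₂=∅ : DisjointF (𝒯 ∪F 𝒯₀) 𝒯₂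
    𝒯∪𝒯₀∩𝒯₂=∅ A (inj₁ (_ , not-Only)) a₂ = not-Only (inj₂ a₂)
    𝒯∪𝒯₀∩𝒯₂=∅ A (inj₂ (_ , m₀ , _)) (_ , _ , e₀ , _) = e₀ m₀
    𝒯₁∩𝒯₂=∅ : DisjointF 𝒯₁ 𝒯₂
    𝒯₁∩𝒯₂=∅ A (_ , m₁ , _) (_ , _ , _ , e₁) = e₁ m₁

  ∧̇⊆Tr : CoveredBy (S₀ ∪ S₂) (S₀ ∪ S₁) →
         NonemptyF (Restrict ℋ ((S₀ ∪ S₁) ∪ S₂)) → (S₀ ∪ S₁) ∪ S₂ ⊆ V₁ →
         ((𝒜 ∪F ℬ) ∪F 𝒞) ⊆F Tr ℋ
  ∧̇⊆Tr cover 𝒫-nonempty S⊆V₁ X (inj₁ (inj₁ ((A , B , a , B-Tr , refl) , _))) =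
    let m₂ , m₁ = meets-both 𝒫-nonempty S⊆V₁ A a in
    Tr-∪-Outer cover (𝒯∪𝒯₀⊆Tr A a) m₂ m₁ B-Tr
  ∧̇⊆Tr cover _ _ X (inj₁ (inj₂ ((A , B , (A-Tr , m₁ , e₀ , e₂) , B-Tr , refl) , _))) =
    Tr-∪-Residual cover A-Tr ([ e₀ , e₂ ] ∘ meets-∪⁻ A S₀ S₂)
      (meets-mono ⊆-refl (q⊆p∪q S₀ S₁) m₁) B-Tr
  ∧̇⊆Tr cover _ _ X (inj₂ ((A , B , (A-Tr , m₂ , e₀ , e₁) , B-Tr , refl) , _)) =
    Tr-∪-Residual (CoveredBy-swap cover) A-Tr ([ e₀ , e₁ ] ∘ meets-∪⁻ A S₀ S₁)
      (meets-mono ⊆-refl (q⊆p∪q S₀ S₂) m₂) B-Tr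

lemma8 : (n : ℕ) (ℋ : Family n) (V₁ S₀ S₁ S₂ : Subset n) →
  let V₂ = ∁ V₁
      ℋ₁ = Restrict ℋ V₁
      ℋ₂ = Restrict ℋ V₂
      ℱ₁ : Family n
      ℱ₁ = λ H → ℋ H × (H ∩ V₁ ≡ S₀ ∪ S₂) × Nonempty (H ∩ V₂)
      ℱ₂ : Family n
      ℱ₂ = λ H → ℋ H × (H ∩ V₁ ≡ S₀ ∪ S₁) × Nonempty (H ∩ V₂)
      Only : Subset n → Subset n → Subset n → Family n
      Only Sᵢ Sⱼ Sₖ = λ T → Tr ℋ₁ T × Nonempty (T ∩ Sᵢ) × Empty (T ∩ Sⱼ) × Empty (T ∩ Sₖ)
      𝒯₀ = Only S₀ S₁ S₂
      𝒯₁ = Only S₁ S₀ S₂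
      𝒯₂ = Only S₂ S₀ S₁
      𝒯 = Tr ℋ₁ ∖F ((𝒯₀ ∪F 𝒯₁) ∪F 𝒯₂)
      ℱ₁′ = Min (Trace ℱ₁ V₂ ∪F ℋ₂)
      ℱ₂′ = Min (Trace ℱ₂ V₂ ∪F ℋ₂)
      𝒫 = Restrict ℋ ((S₀ ∪ S₁) ∪ S₂)
      𝒜 = (𝒯 ∪F 𝒯₀) ∧̇ Tr ℋ₂
      ℬ = 𝒯₁ ∧̇ Tr ℱ₁′
      𝒞 = 𝒯₂ ∧̇ Tr ℱ₂′
  in Sperner ℋ →
     Nonempty V₁ → Nonempty V₂ →
     S₀ ⊆ V₁ → S₁ ⊆ V₁ → S₂ ⊆ V₁ →
     Empty (S₀ ∩ S₁) → Empty (S₀ ∩ S₂) → Empty (S₁ ∩ S₂) →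
     Nonempty S₀ → Nonempty S₁ → Nonempty S₂ →
     NonemptyF ℋ₁ → NonemptyF ℱ₁ → NonemptyF ℱ₂ →
     (∀ H → ℋ H → ((ℋ₁ H ⊎ ℋ₂ H) ⊎ (ℱ₁ H ⊎ ℱ₂ H))) →
     NonemptyF 𝒫 → NonemptyF 𝒯 →
     (DisjointF 𝒜 ℬ × DisjointF 𝒜 𝒞 × DisjointF ℬ 𝒞)
     × ((𝒜 ∪F ℬ) ∪F 𝒞) ⊆F Tr ℋ
lemma8 n ℋ V₁ S₀ S₁ S₂ _ _ _ S₀⊆V₁ S₁⊆V₁ S₂⊆V₁ _ _ _ _ _ _ _ _ _ cover 𝒫-nonempty _ =
  disjoint , ∧̇⊆Tr cover 𝒫-nonempty (∪-lub (∪-lub S₀⊆V₁ S₁⊆V₁) S₂⊆V₁)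
  where open Lemma8 ℋ V₁ S₀ S₁ S₂
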